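{- Let $G$ be a graph and let $H$ be a rooted graph with root $r_H \in V(H)$. Then \[ b(G \,\square\, H) \le b(G \circ H) \le b(G) + \operatorname{ecc}(r_H). \]
   Context: All graphs are finite. For a graph $G$, $d(u,v)$ is graph distance and $B(v,r)=\{u\in V(G): d(u,v)\le r\}$. The burning number is $b(G)=\min\{k : \exists v_1,\dots,v_k\in V(G) \text{ with } V(G)=\bigcup_{i=1}^k B(v_i,k-i)\}$; equivalently, it is the minimum number of rounds needed to burn all vertices when in each round every burning vertex spreads fire to all its neighbors and one new fire may be started at an unburned vertex. $G\,\square\,H$ denotes the Cartesian product. For a rooted graph $H$ with root $r_H$, the rooted product $G\circ H$ is obtained by taking one copy of $G$ and, for each $v\in V(G)$, attaching a separate copy of $H$ by identifying $v$ with the root $r_H$ of that copy. The eccentricity of a vertex $v$ of $H$ is $\operatorname{ecc}(v)=\max_{u\in V(H)} d(u,v)$. -}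

module Defs where

open import Level using (0ℓ)
open import Data.Nat using (ℕ; zero; suc; _+_; _*_; _∸_; _≤_)
open import Data.Fin using (Fin; toℕ)
open import Data.Fin.Properties using (*↔×)
open import Data.Product using (Σ; ∃; ∃-syntax; _×_; _,_; proj₁; proj₂)
open import Data.Sum using (_⊎_)
open import Relation.Binary.PropositionalEquality using (_≡_)
open import Relation.Nullary using (¬_)
open import Function.Bundles using (_↔_)
open import Function.Properties.Inverse using (↔-trans)
open import Data.Product.Function.NonDependent.Propositional using (_×-↔_)

record Graph : Set₁ where
  field
    V     : Set
    size  : ℕ
    enum  : Fin size ↔ V
    Adj   : V → V → Set
    sym   : ∀ {u v} → Adj u v → Adj v u
    irrefl : ∀ {u} → ¬ Adj u u
open Graph public

record RootedGraph : Set₁ where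
  field
    graph : Graph
    root  : V graph
open RootedGraph public

-- Within G u v r  :  d(u,v) ≤ r, i.e. there is a walk of length ≤ r from u to v.
data Within (G : Graph) : V G → V G → ℕ → Set where
  here : ∀ {u r} → Within G u u r
  step : ∀ {u w v r} → Adj G u w → Within G w v r → Within G u v (suc r)

-- v₁,…,vₖ (indexed by Fin k, i ↦ v_{i+1}) is a burning sequence:
-- V(G) = ⋃ᵢ B(vᵢ, k - i), with 1-based i, i.e. radius k ∸ 1 ∸ toℕ i for 0-based i.
IsBurningSeq : (G : Graph) (k : ℕ) → (Fin k → V G) → Set
IsBurningSeq G k v = ∀ (u : V G) → ∃[ i ] Within G (v i) u (k ∸ 1 ∸ toℕ i)

BurnableIn : Graph → ℕ → Set
BurnableIn G k = ∃[ v ] IsBurningSeq G k v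

IsBurningNumber : Graph → ℕ → Set
IsBurningNumber G b = BurnableIn G b × (∀ k → BurnableIn G k → b ≤ k)

IsEccentricity : (H : Graph) → V H → ℕ → Set
IsEccentricity H v e =
  (∀ u → Within H v u e) × (∀ e′ → (∀ u → Within H v u e′) → e ≤ e′)

_□_ : Graph → Graph → Graph
G □ H = record
  { V = V G × V H
  ; size = size G * size H
  ; enum = ↔-trans *↔× (enum G ×-↔ enum H)
  ; Adj = λ { (g , h) (g′ , h′) → (Adj G g g′ × h ≡ h′) ⊎ (g ≡ g′ × Adj H h h′) }
  ; sym = symP
  ; irrefl = irr
  }
  where
  open import Relation.Binary.PropositionalEquality using (refl)
  import Relation.Binary.PropositionalEquality as P
  open import Data.Sum using (inj₁; inj₂)
  symP : ∀ {u v : V G × V H} →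
         (Adj G (proj₁ u) (proj₁ v) × proj₂ u ≡ proj₂ v) ⊎ (proj₁ u ≡ proj₁ v × Adj H (proj₂ u) (proj₂ v)) →
         (Adj G (proj₁ v) (proj₁ u) × proj₂ v ≡ proj₂ u) ⊎ (proj₁ v ≡ proj₁ u × Adj H (proj₂ v) (proj₂ u))
  symP (inj₁ (a , e)) = inj₁ (sym G a , P.sym e)
  symP (inj₂ (e , a)) = inj₂ (P.sym e , sym H a)
  irr : ∀ {u : V G × V H} →
        ¬ ((Adj G (proj₁ u) (proj₁ u) × proj₂ u ≡ proj₂ u) ⊎ (proj₁ u ≡ proj₁ u × Adj H (proj₂ u) (proj₂ u)))
  irr (inj₁ (a , _)) = irrefl G a
  irr (inj₂ (_ , a)) = irrefl H a

-- Rooted product G ∘ H: vertex (g , h) is vertex h of the copy of H attached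
-- at g, with (g , root) identified with g itself.
_∘ᵣ_ : Graph → RootedGraph → Graph
G ∘ᵣ Hr = record
  { V = V G × V H
  ; size = size G * size H
  ; enum = ↔-trans *↔× (enum G ×-↔ enum H)
  ; Adj = λ { (g , h) (g′ , h′) → (Adj G g g′ × h ≡ r × h′ ≡ r) ⊎ (g ≡ g′ × Adj H h h′) }
  ; sym = symP
  ; irrefl = irr
  }
  where
  H = graph Hr
  r = root Hr
  import Relation.Binary.PropositionalEquality as P
  open import Data.Sum using (inj₁; inj₂)
  symP : ∀ {u v : V G × V H} →
         (Adj G (proj₁ u) (proj₁ v) × proj₂ u ≡ r × proj₂ v ≡ r) ⊎ (proj₁ u ≡ proj₁ v × Adj H (proj₂ u) (proj₂ v)) →
         (Adj G (proj₁ v) (proj₁ u) × proj₂ v ≡ r × proj₂ u ≡ r) ⊎ (proj₁ v ≡ proj₁ u × Adj H (proj₂ v) (proj₂ u))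
  symP (inj₁ (a , e , e′)) = inj₁ (sym G a , e′ , e)
  symP (inj₂ (e , a)) = inj₂ (P.sym e , sym H a)
  irr : ∀ {u : V G × V H} →
        ¬ ((Adj G (proj₁ u) (proj₁ u) × proj₂ u ≡ r × proj₂ u ≡ r) ⊎ (proj₁ u ≡ proj₁ u × Adj H (proj₂ u) (proj₂ u)))
  irr (inj₁ (a , _)) = irrefl G a
  irr (inj₂ (_ , a)) = irrefl H a

-- The identity map embeds G ∘ H as a spanning subgraph of G □ H, so every
-- burning sequence of G ∘ H also burns G □ H.  For the upper bound, burn the
-- copy of G sitting on the roots with an optimal burning sequence of G and
-- append e arbitrary fires: every radius grows by e, and every vertex of a
-- copy of H lies within ecc(r_H) = e of its root.
module Submission where

open import Defs
open import Data.Nat using (ℕ; zero; suc; _+_; _∸_; _≤_; z≤n; s≤s)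
open import Data.Nat.Properties using (≤-trans; m≤n+m; +-∸-comm)
open import Function using (id; _∘_)
open import Data.Fin using (Fin; toℕ; _↑ˡ_)
import Data.Fin as Fin
open import Data.Fin.Properties using (toℕ-↑ˡ; toℕ≤pred[n])
open import Data.Vec.Functional using (_++_; replicate)
open import Data.Vec.Functional.Properties using (lookup-++ˡ)
open import Data.Product using (_×_; _,_; proj₁; ∃-syntax)
open import Data.Sum using (inj₁; inj₂)
open import Data.Empty using (⊥-elim)
open import Relation.Nullary using (¬_)
open import Relation.Binary.Core using (_=[_]⇒_)
open import Relation.Binary.PropositionalEquality
  using (_≡_; refl; cong; subst₂; module ≡-Reasoning)
  renaming (sym to ≡-sym)

Within-weaken : ∀ {G u v r s} → Within G u v r → r ≤ s → Within G u v s
Within-weaken here       _       = here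
Within-weaken (step a w) (s≤s p) = step a (Within-weaken w p)

Within-trans : ∀ {G u w v r s} → Within G u w r → Within G w v s → Within G u v (r + s)
Within-trans here       w′ = Within-weaken w′ (m≤n+m _ _)
Within-trans (step a w) w′ = step a (Within-trans w w′)

Within-map : ∀ {G K} {f : V G → V K} → Adj G =[ f ]⇒ Adj K →
             ∀ {u v r} → Within G u v r → Within K (f u) (f v) r
Within-map hom here       = here
Within-map hom (step a w) = step (hom a) (Within-map hom w)

BurnableIn-map : ∀ {G K} {f : V G → V K} → Adj G =[ f ]⇒ Adj K →
                 (∀ y → ∃[ x ] f x ≡ y) → ∀ {k} → BurnableIn G k → BurnableIn K k
BurnableIn-map {f = f} hom onto (v , burns) = (λ i → f (v i)) , covers
  where
  covers : ∀ y → ∃[ i ] Within _ (f (v i)) y _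
  covers y with onto y
  ... | x , refl with burns x
  ...   | i , w = i , Within-map hom w

pad-radius : ∀ {k} (i : Fin k) e → (k ∸ 1 ∸ toℕ i) + e ≡ k + e ∸ 1 ∸ toℕ (i ↑ˡ e)
pad-radius {suc n} i e = begin
  (n ∸ toℕ i) + e       ≡⟨ ≡-sym (+-∸-comm e (toℕ≤pred[n] i)) ⟩
  n + e ∸ toℕ i         ≡⟨ cong (n + e ∸_) (≡-sym (toℕ-↑ˡ i e)) ⟩
  n + e ∸ toℕ (i ↑ˡ e)  ∎
  where open ≡-Reasoning

BurnableIn-dominating : ∀ {G K} {f : V G → V K} {e} → Adj G =[ f ]⇒ Adj K →
                        (∀ y → ∃[ x ] Within K (f x) y e) →
                        ∀ {n} → BurnableIn G (suc n) → BurnableIn K (suc n + e)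
BurnableIn-dominating {K = K} {f} {e} hom dominates {n} (v , burns) = fires , covers
  where
  fires : Fin (suc n + e) → V K
  fires = (λ i → f (v i)) ++ replicate e (f (v Fin.zero))
  covers : IsBurningSeq K (suc n + e) fires
  covers y with dominates y
  ... | x , near with burns x
  ...   | i , far = i ↑ˡ e ,
    subst₂ (λ z r → Within K z y r) (≡-sym (lookup-++ˡ _ _ i)) (pad-radius i e)
           (Within-trans (Within-map hom far) near)

BurnableIn-zero⇒empty : ∀ {G} → BurnableIn G 0 → ¬ V G
BurnableIn-zero⇒empty (_ , burns) x with burns x
... | () , _

empty⇒BurnableIn-zero : ∀ {G} → ¬ V G → BurnableIn G 0
empty⇒BurnableIn-zero empty = (λ ()) , λ x → ⊥-elim (empty x)

module _ (G : Graph) (H : RootedGraph) where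

  private
    r = root H

  ∘ᵣ⊆□ : Adj (G ∘ᵣ H) =[ id ]⇒ Adj (G □ graph H)
  ∘ᵣ⊆□ (inj₁ (a , refl , refl)) = inj₁ (a , refl)
  ∘ᵣ⊆□ (inj₂ e×a)               = inj₂ e×a

  root-embedding : Adj G =[ (λ g → g , r) ]⇒ Adj (G ∘ᵣ H)
  root-embedding a = inj₁ (a , refl , refl)

  copy-embedding : ∀ g → Adj (graph H) =[ (λ h → g , h) ]⇒ Adj (G ∘ᵣ H)
  copy-embedding g a = inj₂ (refl , a)

  roots-dominating : ∀ {e} → (∀ h → Within (graph H) r h e) →
                     ∀ y → ∃[ g ] Within (G ∘ᵣ H) (g , r) y e
  roots-dominating ecc (g , h) = g , Within-map (copy-embedding g) (ecc h)

theorem1p2 : (G : Graph) (H : RootedGraph) (bG b□ b∘ e : ℕ) →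
    IsBurningNumber G bG →
    IsBurningNumber (G □ graph H) b□ →
    IsBurningNumber (G ∘ᵣ H) b∘ →
    IsEccentricity (graph H) (root H) e →
    (b□ ≤ b∘) × (b∘ ≤ bG + e)
theorem1p2 G H bG b□ b∘ e (burnG , _) (_ , least□) (burn∘ , least∘) (ecc , _) =
  least□ b∘ (BurnableIn-map (∘ᵣ⊆□ G H) (λ y → y , refl) burn∘) , upper bG burnG
  where
  upper : ∀ k → BurnableIn G k → b∘ ≤ k + e
  upper zero    burn =
    ≤-trans (least∘ 0 (empty⇒BurnableIn-zero (BurnableIn-zero⇒empty burn ∘ proj₁))) z≤n
  upper (suc n) burn =
    least∘ (suc n + e)
      (BurnableIn-dominating (root-embedding G H) (roots-dominating G H ecc) burn)
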